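{- For each $n\ge1$, the sequence $C(n,0),C(n,1),C(n,2),\dots$ is log-concave.
   Context: For $n,k\ge0$, $C(n,k)$ is the number of $(x_1,\dots,x_{k+1})\in\mathbb{Z}^{k+1}$ with $|x_1|+\cdots+|x_{k+1}|=n$; equivalently $\sum_{n,k\ge0}C(n,k)x^ny^k=\frac{1+x}{1-x-y-xy}$. A sequence $(a_k)_{k\ge0}$ of nonnegative numbers is log-concave if $a_{k-1}a_{k+1}\le a_k^2$ for all $k\ge1$. -}

module Defs where

open import Data.Nat using (ℕ; zero; suc; _+_; _*_; _∸_)
open import Data.List using (List; map; upTo)
open import Data.Nat.ListAction using (sum)

-- number of integers x with |x| = a : 1 if a = 0, 2 otherwise
absCount : ℕ → ℕ
absCount zero    = 1
absCount (suc _) = 2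

-- tuples n m = #{ (x_1,…,x_m) ∈ ℤ^m : |x_1| + … + |x_m| = n },
-- computed by splitting on the value a = |x_1| ∈ {0,…,n}
tuples : ℕ → ℕ → ℕ
tuples zero    zero    = 1
tuples (suc _) zero    = 0
tuples n       (suc m) = sum (map (λ a → absCount a * tuples (n ∸ a) m) (upTo (suc n)))

-- C(n,k) = #{ x ∈ ℤ^(k+1) : |x_1| + … + |x_(k+1)| = n }
C : ℕ → ℕ → ℕ
C n k = tuples n (suc k)

LogConcave : (ℕ → ℕ) → Set
LogConcave a = ∀ k → a k * a (suc (suc k)) Data.Nat.≤ a (suc k) * a (suc k)

{-# OPTIONS --safe #-}
-- Expanding the generating function gives C(n+1,k+1) = C(n,k+1) + C(n+1,k) + C(n,k), and
-- C(n,0) = 2 for n ≥ 1. Hence for n ≥ 1 the row C(n+1,·) arises from the row C(n,·) by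
-- taking adjacent sums a_k + a_(k-1) and then partial sums, i.e. by multiplying its
-- generating function by (1+y)/(1-y); the first row C(1,k) = 2(k+1) is the sequence of
-- partial sums of the constant sequence 2. Both operations preserve log-concavity of
-- positive sequences, since such a sequence satisfies a_j a_(l+1) ≤ a_(j+1) a_l for all j ≤ l.
module Submission where

open import Defs
open import Data.Nat using (ℕ; _≥_)
open import Data.Nat.Base using (zero; suc; _+_; _*_; _∸_; _≤_; _<_; _≤′_; ≤′-refl; ≤′-step; z<s; >-nonZero)
open import Data.Nat.Properties
open import Data.Nat.ListAction using (sum)
open import Data.List using (applyUpTo)
open import Data.List.Properties using (map-applyUpTo)
open import Data.Product using (_×_; _,_; proj₂)
open import Function using (const)
open import Relation.Binary.PropositionalEquality
open import Data.Nat.Tactic.RingSolver using (solve-∀)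
open import Algebra.Properties.CommutativeSemigroup *-commutativeSemigroup using (x∙yz≈y∙xz; xy∙z≈y∙xz)

Positive : (ℕ → ℕ) → Set
Positive a = ∀ k → 0 < a k

PositiveLogConcave : (ℕ → ℕ) → Set
PositiveLogConcave a = Positive a × LogConcave a

positiveLogConcave-resp-≗ : ∀ {f g : ℕ → ℕ} → f ≗ g → PositiveLogConcave g → PositiveLogConcave f
positiveLogConcave-resp-≗ f≗g (g-pos , g-lc) =
  (λ k → subst (0 <_) (sym (f≗g k)) (g-pos k)) ,
  (λ k → subst₂ _≤_ (sym (cong₂ _*_ (f≗g k) (f≗g (2 + k))))
                    (sym (cong₂ _*_ (f≗g (1 + k)) (f≗g (1 + k)))) (g-lc k))

partialSum : (ℕ → ℕ) → ℕ → ℕ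
partialSum a zero    = a 0
partialSum a (suc k) = partialSum a k + a (suc k)

adjacentSum : (ℕ → ℕ) → ℕ → ℕ
adjacentSum a zero    = a 0
adjacentSum a (suc k) = a (suc k) + a k

module _ {a : ℕ → ℕ} (a-pos : Positive a) (a-lc : LogConcave a) where
  open ≤-Reasoning

  cross-≤ : ∀ {j l} → j ≤ l → a j * a (suc l) ≤ a (suc j) * a l
  cross-≤ j≤l = go (≤⇒≤′ j≤l)
    where
    go : ∀ {j l} → j ≤′ l → a j * a (suc l) ≤ a (suc j) * a l
    go {j} ≤′-refl = ≤-reflexive (*-comm (a j) (a (suc j)))
    go {j} {suc l} (≤′-step j≤l) = *-cancelˡ-≤ (a l) {{>-nonZero (a-pos l)}} (begin
      a l * (a j * a (2 + l))       ≡⟨ x∙yz≈y∙xz (a l) (a j) (a (2 + l)) ⟩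
      a j * (a l * a (2 + l))       ≤⟨ *-monoʳ-≤ (a j) (a-lc l) ⟩
      a j * (a (1 + l) * a (1 + l)) ≡⟨ *-assoc (a j) (a (1 + l)) (a (1 + l)) ⟨
      a j * a (1 + l) * a (1 + l)   ≤⟨ *-monoˡ-≤ (a (1 + l)) (go j≤l) ⟩
      a (1 + j) * a l * a (1 + l)   ≡⟨ xy∙z≈y∙xz (a (1 + j)) (a l) (a (1 + l)) ⟩
      a l * (a (1 + j) * a (1 + l)) ∎)

  partialSum-cross-≤ : ∀ {k l} → k ≤ l → partialSum a k * a (suc l) ≤ partialSum a (suc k) * a l
  partialSum-cross-≤ {zero} {l} 0≤l = begin
    a 0 * a (suc l)     ≤⟨ cross-≤ 0≤l ⟩
    a 1 * a l           ≤⟨ *-monoˡ-≤ (a l) (m≤n+m (a 1) (a 0)) ⟩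
    (a 0 + a 1) * a l   ∎
  partialSum-cross-≤ {suc k} {l} k<l = begin
    (S k + a (1 + k)) * a (1 + l)             ≡⟨ *-distribʳ-+ (a (1 + l)) (S k) (a (1 + k)) ⟩
    S k * a (1 + l) + a (1 + k) * a (1 + l)   ≤⟨ +-mono-≤ (partialSum-cross-≤ (<⇒≤ k<l)) (cross-≤ k<l) ⟩
    S (1 + k) * a l + a (2 + k) * a l         ≡⟨ *-distribʳ-+ (a l) (S (1 + k)) (a (2 + k)) ⟨
    (S (1 + k) + a (2 + k)) * a l             ∎
    where S = partialSum a

  partialSum-logConcave : LogConcave (partialSum a)
  partialSum-logConcave k = begin
    S k * (S (1 + k) + a (2 + k))             ≡⟨ *-distribˡ-+ (S k) (S (1 + k)) (a (2 + k)) ⟩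
    S k * S (1 + k) + S k * a (2 + k)         ≤⟨ +-monoʳ-≤ (S k * S (1 + k)) (partialSum-cross-≤ (n≤1+n k)) ⟩
    S k * S (1 + k) + S (1 + k) * a (1 + k)   ≡⟨ cong (_+ S (1 + k) * a (1 + k)) (*-comm (S k) (S (1 + k))) ⟩
    S (1 + k) * S k + S (1 + k) * a (1 + k)   ≡⟨ *-distribˡ-+ (S (1 + k)) (S k) (a (1 + k)) ⟨
    S (1 + k) * (S k + a (1 + k))             ∎
    where S = partialSum a

  adjacentSum-logConcave : LogConcave (adjacentSum a)
  adjacentSum-logConcave zero = begin
    a 0 * (a 2 + a 1)           ≡⟨ *-distribˡ-+ (a 0) (a 2) (a 1) ⟩
    a 0 * a 2 + a 0 * a 1       ≤⟨ +-monoˡ-≤ (a 0 * a 1) (a-lc 0) ⟩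
    a 1 * a 1 + a 0 * a 1       ≡⟨ *-distribʳ-+ (a 1) (a 1) (a 0) ⟨
    (a 1 + a 0) * a 1           ≤⟨ *-monoʳ-≤ (a 1 + a 0) (m≤m+n (a 1) (a 0)) ⟩
    (a 1 + a 0) * (a 1 + a 0)   ∎
  adjacentSum-logConcave (suc k) = begin
    (q + p) * (s + r)           ≡⟨ *-distribʳ-+ (s + r) q p ⟩
    q * (s + r) + p * (s + r)   ≤⟨ +-mono-≤ outer inner ⟩
    (r + q) * r + (r + q) * q   ≡⟨ *-distribˡ-+ (r + q) r q ⟨
    (r + q) * (r + q)           ∎
    where
    p = a k
    q = a (1 + k)
    r = a (2 + k)
    s = a (3 + k)
    outer : q * (s + r) ≤ (r + q) * r
    outer = begin
      q * (s + r)     ≡⟨ *-distribˡ-+ q s r ⟩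
      q * s + q * r   ≤⟨ +-monoˡ-≤ (q * r) (a-lc (suc k)) ⟩
      r * r + q * r   ≡⟨ *-distribʳ-+ r r q ⟨
      (r + q) * r     ∎
    inner : p * (s + r) ≤ (r + q) * q
    inner = begin
      p * (s + r)     ≡⟨ *-distribˡ-+ p s r ⟩
      p * s + p * r   ≤⟨ +-mono-≤ (cross-≤ (m≤n+m k 2)) (a-lc k) ⟩
      q * r + q * q   ≡⟨ cong (_+ q * q) (*-comm q r) ⟩
      r * q + q * q   ≡⟨ *-distribʳ-+ q r q ⟨
      (r + q) * q     ∎

partialSum-positiveLogConcave : ∀ {a} → PositiveLogConcave a → PositiveLogConcave (partialSum a)
partialSum-positiveLogConcave {a} (a-pos , a-lc) = positive , partialSum-logConcave a-pos a-lc
  where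
  positive : Positive (partialSum a)
  positive zero    = a-pos 0
  positive (suc k) = <-≤-trans (positive k) (m≤m+n _ _)

adjacentSum-positiveLogConcave : ∀ {a} → PositiveLogConcave a → PositiveLogConcave (adjacentSum a)
adjacentSum-positiveLogConcave {a} (a-pos , a-lc) = positive , adjacentSum-logConcave a-pos a-lc
  where
  positive : Positive (adjacentSum a)
  positive zero    = a-pos 0
  positive (suc k) = <-≤-trans (a-pos (suc k)) (m≤m+n _ _)

tuplesNonzeroHead : ℕ → ℕ → ℕ
tuplesNonzeroHead m n = sum (applyUpTo (λ i → 2 * tuples (n ∸ suc i) m) n)

tuples-split : ∀ n m → tuples n (suc m) ≡ tuples n m + tuplesNonzeroHead m n
tuples-split zero    m = cong (_+ 0) (+-identityʳ (tuples 0 m))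
tuples-split (suc n) m = cong₂ _+_ (+-identityʳ (tuples (suc n) m)) (cong sum (map-applyUpTo suc _ (suc n)))

tuples-zero : ∀ m → tuples 0 m ≡ 1
tuples-zero zero    = refl
tuples-zero (suc m) = cong (λ t → t + 0 + 0) (tuples-zero m)

tuples-suc-suc : ∀ n m → tuples (suc n) (suc m) ≡ tuples n (suc m) + tuples (suc n) m + tuples n m
tuples-suc-suc n m = begin
  tuples (suc n) (suc m)                                   ≡⟨ tuples-split (suc n) m ⟩
  tuples (suc n) m + (2 * tuples n m + H)                  ≡⟨ rearrange (tuples (suc n) m) (tuples n m) H ⟩
  tuples n m + H + tuples (suc n) m + tuples n m           ≡⟨ cong (λ t → t + tuples (suc n) m + tuples n m) (tuples-split n m) ⟨
  tuples n (suc m) + tuples (suc n) m + tuples n m         ∎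
  where
  open ≡-Reasoning
  H = tuplesNonzeroHead m n
  rearrange : ∀ x y z → x + (2 * y + z) ≡ y + z + x + y
  rearrange = solve-∀

C-suc-zero : ∀ n → C (suc n) 0 ≡ 2
C-suc-zero zero    = refl
C-suc-zero (suc n) = trans (tuples-suc-suc (suc n) 0) (cong (λ t → t + 0 + 0) (C-suc-zero n))

C-one : C 1 ≗ partialSum (const 2)
C-one zero    = refl
C-one (suc k) = begin
  C 1 (suc k)                                 ≡⟨ tuples-suc-suc 0 (suc k) ⟩
  tuples 0 (2 + k) + C 1 k + tuples 0 (1 + k) ≡⟨ cong₂ (λ x y → x + C 1 k + y) (tuples-zero (2 + k)) (tuples-zero (1 + k)) ⟩
  1 + C 1 k + 1                               ≡⟨ +-comm (1 + C 1 k) 1 ⟩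
  2 + C 1 k                                   ≡⟨ +-comm 2 (C 1 k) ⟩
  C 1 k + 2                                   ≡⟨ cong (_+ 2) (C-one k) ⟩
  partialSum (const 2) k + 2                  ∎
  where open ≡-Reasoning

C-suc-suc : ∀ n → C (suc (suc n)) ≗ partialSum (adjacentSum (C (suc n)))
C-suc-suc n zero    = trans (C-suc-zero (suc n)) (sym (C-suc-zero n))
C-suc-suc n (suc k) = begin
  C (2 + n) (1 + k)                                 ≡⟨ tuples-suc-suc (suc n) (suc k) ⟩
  C (1 + n) (1 + k) + C (2 + n) k + C (1 + n) k     ≡⟨ cong (_+ C (1 + n) k) (+-comm (C (1 + n) (1 + k)) (C (2 + n) k)) ⟩
  C (2 + n) k + C (1 + n) (1 + k) + C (1 + n) k     ≡⟨ +-assoc (C (2 + n) k) (C (1 + n) (1 + k)) (C (1 + n) k) ⟩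
  C (2 + n) k + adjacentSum (C (1 + n)) (1 + k)     ≡⟨ cong (_+ adjacentSum (C (1 + n)) (1 + k)) (C-suc-suc n k) ⟩
  partialSum (adjacentSum (C (1 + n))) (1 + k)      ∎
  where open ≡-Reasoning

C-suc-positiveLogConcave : ∀ n → PositiveLogConcave (C (suc n))
C-suc-positiveLogConcave zero =
  positiveLogConcave-resp-≗ C-one (partialSum-positiveLogConcave ((λ _ → z<s) , (λ _ → ≤-refl)))
C-suc-positiveLogConcave (suc n) =
  positiveLogConcave-resp-≗ (C-suc-suc n)
    (partialSum-positiveLogConcave (adjacentSum-positiveLogConcave (C-suc-positiveLogConcave n)))

mainTheorem11 : ∀ (n : ℕ) → n ≥ 1 → LogConcave (C n)
mainTheorem11 (suc n) _ = proj₂ (C-suc-positiveLogConcave n)
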